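{- Let $p,q$ be primes which are not both equal to $2$, and let $a,b$ be distinct coprime integers such that $a^p-b^p=c^q$ for some integer $c$ with $p\nmid c^q$ (i.e. $a^p-b^p$ is a $q$-th power of an integer and is not divisible by $p$). Then $a-b$ is a $q$-th power of an integer. -}

module Defs where

module Submission where

-- Put D = a - b and Φ = Φ a b p = a^(p-1) + a^(p-2) b + ... + b^(p-1),
-- so that D * Φ = a^p - b^p = c^q.
--   * Modulo D we have a ≡ b, hence b * Φ ≡ p * b^p; a common divisor d of D and Φ
--     is coprime to b (as a and b are coprime), so d divides p.  Since p is prime and
--     p ∤ D (otherwise p ∣ D * Φ = c^q), D and Φ are coprime.
--   * In ℕ, if m * n is a q-th power and gcd(m, n) = 1 then m is a q-th power
--     (strong induction on m, peeling off the full power r^q of a prime r ∣ m).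
--     Applied to ∣D∣ * ∣Φ∣ = ∣c∣^q this gives ∣D∣ = e^q.
--   * To recover D itself from ∣D∣: if D ≥ 0 take e; if q is odd take -e.  If q is
--     even then q = 2, so p is odd, and since odd powers reflect ≤ the inequality
--     a^p - b^p = c^2 ≥ 0 forces D ≥ 0.
-- The file develops, in order: coprime factors of perfect powers in ℕ
-- (CoprimeFactorsOfPowers), powers of integers and parity (IntegerPowers), the
-- geometric sum Φ and the coprimality of D and Φ (GeometricSum), and finally the
-- theorem.

module CoprimeFactorsOfPowers where

  open import Data.Nat
  open import Data.Nat.Properties
  open import Data.Nat.Divisibility
  open import Data.Nat.Coprimality using (Coprime; coprime-divisor)
  import Data.Nat.Coprimality as Coprimality
  open import Data.Nat.Primality
  open import Data.Nat.Primality.Factorisation using (PrimeFactorisation; factorise)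
  open import Data.Nat.Induction using (<-rec)
  open import Data.List using ([]; _∷_)
  open import Data.List.Relation.Unary.All using (_∷_)
  open import Data.Nat.ListAction using (product)
  open import Data.Product
  open import Data.Sum using (inj₁; inj₂)
  open import Data.Empty using (⊥-elim)
  open import Relation.Binary.PropositionalEquality
  open import Data.Nat.Tactic.RingSolver using (solve-∀)

  coprime-∣ˡ : ∀ {m n d} → Coprime m n → d ∣ m → Coprime d n
  coprime-∣ˡ m⊥n d∣m (e∣d , e∣n) = m⊥n (∣-trans e∣d d∣m , e∣n)

  coprime-*ˡ : ∀ {a b n} → Coprime a n → Coprime b n → Coprime (a * b) n
  coprime-*ˡ {a} a⊥n b⊥n {d} (d∣ab , d∣n) = b⊥n (coprime-divisor d⊥a d∣ab , d∣n)
    where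
    d⊥a : Coprime d a
    d⊥a = coprime-∣ˡ (Coprimality.sym a⊥n) d∣n

  coprime-^ˡ : ∀ {a n} k → Coprime a n → Coprime (a ^ k) n
  coprime-^ˡ zero    _   (d∣1 , _) = ∣1⇒≡1 d∣1
  coprime-^ˡ (suc k) a⊥n = coprime-*ˡ a⊥n (coprime-^ˡ k a⊥n)

  prime∣^⇒prime∣ : ∀ {r k} n → Prime r → r ∣ k ^ n → r ∣ k
  prime∣^⇒prime∣ zero    pr r∣1 =
    ⊥-elim (nonTrivial⇒≢1 {{prime⇒nonTrivial pr}} (∣1⇒≡1 r∣1))
  prime∣^⇒prime∣ {k = k} (suc n) pr r∣k^n+1 with euclidsLemma k (k ^ n) pr r∣k^n+1
  ... | inj₁ r∣k   = r∣k
  ... | inj₂ r∣k^n = prime∣^⇒prime∣ n pr r∣k^n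

  ^-distribʳ-* : ∀ a b n → (a * b) ^ n ≡ a ^ n * b ^ n
  ^-distribʳ-* a b zero    = refl
  ^-distribʳ-* a b (suc n) = begin
    a * b * (a * b) ^ n     ≡⟨ cong (a * b *_) (^-distribʳ-* a b n) ⟩
    a * b * (a ^ n * b ^ n) ≡⟨ interchange a b (a ^ n) (b ^ n) ⟩
    a * a ^ n * (b * b ^ n) ∎
    where
    open ≡-Reasoning
    interchange : ∀ a b x y → a * b * (x * y) ≡ a * x * (b * y)
    interchange = solve-∀

  prime-divisor : ∀ m → 1 < m → ∃[ r ] (Prime r × r ∣ m)
  prime-divisor m@(suc _) 1<m = first-factor (factorise m)
    where
    first-factor : PrimeFactorisation m → ∃[ r ] (Prime r × r ∣ m)
    first-factor record { factors = [] ; isFactorisation = m≡1 } =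
      ⊥-elim (<-irrefl (sym m≡1) 1<m)
    first-factor record { factors = r ∷ rs ; isFactorisation = m≡r*rs
                        ; factorsPrime = pr ∷ _ } =
      r , pr , divides (product rs) (trans m≡r*rs (*-comm r (product rs)))

  remove-prime-power : ∀ {r m n k} e → Prime r → r ∣ m → Coprime m n →
                       m * n ≡ k ^ e →
                       ∃₂ λ m′ j → m ≡ m′ * r ^ e × m′ * n ≡ j ^ e
  remove-prime-power {r} {m} {n} {k} e pr r∣m m⊥n mn≡k^e
    with prime∣^⇒prime∣ e pr (∣-trans r∣m (divides n (trans (sym mn≡k^e) (*-comm m n))))
  ... | divides j k≡jr = m′ , j , m≡m′rᵉ , *-cancelʳ-≡ (m′ * n) (j ^ e) (r ^ e) m′nrᵉ≡jᵉrᵉ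
    where
    open ≡-Reasoning
    instance
      r≢0 : NonZero r
      r≢0 = prime⇒nonZero pr
      rᵉ≢0 : NonZero (r ^ e)
      rᵉ≢0 = m^n≢0 r e
    mn≡jᵉrᵉ : m * n ≡ j ^ e * r ^ e
    mn≡jᵉrᵉ = trans mn≡k^e (trans (cong (_^ e) k≡jr) (^-distribʳ-* j r e))
    rᵉ∣m : r ^ e ∣ m
    rᵉ∣m = coprime-divisor (coprime-^ˡ e (coprime-∣ˡ m⊥n r∣m))
                           (divides (j ^ e) (trans (*-comm n m) mn≡jᵉrᵉ))
    m′ : ℕ
    m′ = quotient rᵉ∣m
    m≡m′rᵉ : m ≡ m′ * r ^ e
    m≡m′rᵉ = m∣n⇒n≡quotient*m rᵉ∣m
    *-right-comm : ∀ x y z → x * y * z ≡ x * z * y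
    *-right-comm = solve-∀
    m′nrᵉ≡jᵉrᵉ : m′ * n * r ^ e ≡ j ^ e * r ^ e
    m′nrᵉ≡jᵉrᵉ = begin
      m′ * n * r ^ e   ≡⟨ *-right-comm m′ n (r ^ e) ⟩
      m′ * r ^ e * n   ≡⟨ cong (_* n) (sym m≡m′rᵉ) ⟩
      m * n            ≡⟨ mn≡jᵉrᵉ ⟩
      j ^ e * r ^ e    ∎

  cofactor< : ∀ {m m′ s} .{{_ : NonZero m}} → m ≡ m′ * s → 1 < s → m′ < m
  cofactor< {m} {m′ = zero}  _ _ = >-nonZero⁻¹ m
  cofactor< {m′ = suc _} {s} m≡m′s 1<s = subst (_ <_) (sym m≡m′s) (m<m*n _ s 1<s)

  coprime-factor-of-power : ∀ e .{{_ : NonZero e}} m n k → Coprime m n →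
                            m * n ≡ k ^ e → ∃[ t ] (m ≡ t ^ e)
  coprime-factor-of-power e = <-rec Goal step
    where
    Goal : ℕ → Set
    Goal m = ∀ n k → Coprime m n → m * n ≡ k ^ e → ∃[ t ] (m ≡ t ^ e)
    step : ∀ m → (∀ {m′} → m′ < m → Goal m′) → Goal m
    step zero          _  n k _   0≡kᵉ = k , 0≡kᵉ
    step (suc zero)    _  n k _   _    = 1 , sym (^-zeroˡ e)
    step m@(suc (suc _)) IH n k m⊥n mn≡kᵉ
      with prime-divisor m (s≤s (s≤s z≤n))
    ... | r , pr , r∣m
      with remove-prime-power e pr r∣m m⊥n mn≡kᵉ
    ... | m′ , j , m≡m′rᵉ , m′n≡jᵉ
      with IH (cofactor< m≡m′rᵉ 1<rᵉ) n j m′⊥n m′n≡jᵉ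
      where
      1<rᵉ : 1 < r ^ e
      1<rᵉ = ^-monoʳ-< r (nonTrivial⇒n>1 r {{prime⇒nonTrivial pr}}) (>-nonZero⁻¹ e)
      m′⊥n : Coprime m′ n
      m′⊥n = coprime-∣ˡ m⊥n (divides (r ^ e) (trans m≡m′rᵉ (*-comm m′ (r ^ e))))
    ... | t , m′≡tᵉ = t * r , (begin
      m             ≡⟨ m≡m′rᵉ ⟩
      m′ * r ^ e    ≡⟨ cong (_* r ^ e) m′≡tᵉ ⟩
      t ^ e * r ^ e ≡⟨ sym (^-distribʳ-* t r e) ⟩
      (t * r) ^ e   ∎)
      where open ≡-Reasoning

module IntegerPowers where

  open import Data.Nat as ℕ using (ℕ; zero; suc)
  import Data.Nat.Properties as ℕ
  import Data.Nat.Divisibility as ℕ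
  open import Data.Nat.Primality using (Prime; prime⇒irreducible)
  open import Data.Integer hiding (suc)
  open import Data.Integer.Properties
  open import Data.Integer.Tactic.RingSolver using (solve-∀)
  open import Data.Product using (∃-syntax; _,_)
  open import Data.Sum using (_⊎_; inj₁; inj₂)
  open import Relation.Nullary using (yes; no; contradiction)
  open import Relation.Binary.PropositionalEquality

  abs-^ : ∀ x n → ∣ x ^ n ∣ ≡ ∣ x ∣ ℕ.^ n
  abs-^ x zero    = refl
  abs-^ x (suc n) = trans (abs-* x (x ^ n)) (cong (∣ x ∣ ℕ.*_) (abs-^ x n))

  pos-^ : ∀ m n → (+ m) ^ n ≡ + (m ℕ.^ n)
  pos-^ m zero    = refl
  pos-^ m (suc n) = trans (cong (+ m *_) (pos-^ m n)) (sym (pos-* m (m ℕ.^ n)))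

  -- n is odd: n = 2k + 1 (written with k * 2, which computes on suc k).
  Odd : ℕ → Set
  Odd n = ∃[ k ] (n ≡ suc (k ℕ.* 2))

  even∨odd : ∀ n → ∃[ k ] (n ≡ k ℕ.* 2) ⊎ Odd n
  even∨odd zero          = inj₁ (0 , refl)
  even∨odd (suc zero)    = inj₂ (0 , refl)
  even∨odd (suc (suc n)) with even∨odd n
  ... | inj₁ (k , n≡2k)   = inj₁ (suc k , cong (λ m → suc (suc m)) n≡2k)
  ... | inj₂ (k , n≡2k+1) = inj₂ (suc k , cong (λ m → suc (suc m)) n≡2k+1)

  prime⇒≡2∨odd : ∀ {p} → Prime p → p ≡ 2 ⊎ Odd p
  prime⇒≡2∨odd {p} pp with even∨odd p
  ... | inj₂ odd = inj₂ odd
  ... | inj₁ (k , p≡2k) with prime⇒irreducible pp (ℕ.divides k p≡2k)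
  ...   | inj₁ ()
  ...   | inj₂ 2≡p = inj₁ (sym 2≡p)

  neg-^-odd : ∀ x {n} → Odd n → (- x) ^ n ≡ - (x ^ n)
  neg-^-odd x (zero  , refl) = neg-one x
    where
    neg-one : ∀ x → (- x) * 1ℤ ≡ - (x * 1ℤ)
    neg-one = solve-∀
  neg-^-odd x (suc k , refl) =
    trans (cong (λ y → (- x) * ((- x) * y)) (neg-^-odd x (k , refl)))
          (neg-two x (x ^ suc (k ℕ.* 2)))
    where
    neg-two : ∀ x y → (- x) * ((- x) * (- y)) ≡ - (x * (x * y))
    neg-two = solve-∀

  odd⇒nonZero : ∀ {n} → Odd n → ℕ.NonZero n
  odd⇒nonZero (_ , refl) = _

  neg-pos-^ : ∀ {n} → Odd n → ∀ m → -[1+ m ] ^ n ≡ - (+ (suc m ℕ.^ n))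
  neg-pos-^ {n} odd m = trans (neg-^-odd (+ suc m) odd) (cong -_ (pos-^ (suc m) n))

  ^-monoˡ-<-odd : ∀ {n x y} → Odd n → x < y → x ^ n < y ^ n
  ^-monoˡ-<-odd {n} odd (+<+ {m} {m′} m<m′) =
    subst₂ _<_ (sym (pos-^ m n)) (sym (pos-^ m′ n))
      (+<+ (ℕ.^-monoˡ-< n {{odd⇒nonZero odd}} m<m′))
  ^-monoˡ-<-odd {n} odd (-<+ {m} {m′}) =
    subst₂ _<_ (sym (neg-pos-^ odd m)) (sym (pos-^ m′ n))
      (neg<pos (suc m ℕ.^ n) {{ℕ.m^n≢0 (suc m) n}})
    where
    neg<pos : ∀ t .{{_ : ℕ.NonZero t}} → - (+ t) < + (m′ ℕ.^ n)
    neg<pos (suc t) = -<+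
  ^-monoˡ-<-odd {n} odd (-<- {m} {m′} m′<m) =
    subst₂ _<_ (sym (neg-pos-^ odd m)) (sym (neg-pos-^ odd m′))
      (neg-mono-< (+<+ (ℕ.^-monoˡ-< n {{odd⇒nonZero odd}} (ℕ.s≤s m′<m))))

  ^-cancelˡ-≤-odd : ∀ {n x y} → Odd n → x ^ n ≤ y ^ n → x ≤ y
  ^-cancelˡ-≤-odd {x = x} {y} odd xⁿ≤yⁿ with x ≤? y
  ... | yes x≤y = x≤y
  ... | no  x≰y = contradiction xⁿ≤yⁿ (<⇒≱ (^-monoˡ-<-odd odd (≰⇒> x≰y)))

  root-from-abs : ∀ x {e n} → ∣ x ∣ ≡ e ℕ.^ n → 0ℤ ≤ x ⊎ Odd n → ∃[ d ] (x ≡ d ^ n)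
  root-from-abs (+ m)    {e} {n} m≡eⁿ _ = + e , trans (cong +_ m≡eⁿ) (sym (pos-^ e n))
  root-from-abs -[1+ m ] {e} {n} m+1≡eⁿ (inj₂ odd) = - (+ e) , (begin
    - (+ suc m)       ≡⟨ cong (λ t → - (+ t)) m+1≡eⁿ ⟩
    - (+ (e ℕ.^ n))   ≡⟨ cong -_ (sym (pos-^ e n)) ⟩
    - ((+ e) ^ n)     ≡⟨ sym (neg-^-odd (+ e) odd) ⟩
    (- (+ e)) ^ n     ∎)
    where open ≡-Reasoning
  root-from-abs -[1+ m ] _ (inj₁ ())

  square-nonneg : ∀ x → 0ℤ ≤ x ^ 2
  square-nonneg +0       = +≤+ ℕ.z≤n
  square-nonneg +[1+ n ] = +≤+ ℕ.z≤n
  square-nonneg -[1+ n ] = +≤+ ℕ.z≤n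

module GeometricSum where

  open import Data.Nat as ℕ using (ℕ; zero; suc)
  import Data.Nat.Properties as ℕ
  import Data.Nat.Divisibility as ℕ
  import Data.Nat.Coprimality as ℕ
  open import Data.Nat.Primality using (Prime; prime⇒irreducible)
  open import Data.Integer hiding (suc)
  open import Data.Integer.Properties using (abs-*)
  open import Data.Integer.Divisibility using (_∣_)
  open import Data.Integer.Coprimality using (Coprime)
  import Data.Integer.Divisibility.Signed as Signed
  open import Data.Integer.Tactic.RingSolver using (solve-∀)
  open import Data.Product using (_,_)
  open import Data.Sum using (inj₁; inj₂)
  open import Data.Empty using (⊥-elim)
  open import Relation.Nullary using (¬_)
  open import Relation.Binary.PropositionalEquality
  open CoprimeFactorsOfPowers using (coprime-^ˡ)
  open IntegerPowers using (abs-^)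

  Φ : ℤ → ℤ → ℕ → ℤ
  Φ a b zero    = 0ℤ
  Φ a b (suc n) = a ^ n + b * Φ a b n

  Φ-factor : ∀ a b n → (a - b) * Φ a b n ≡ a ^ n - b ^ n
  Φ-factor a b zero    = base a b
    where
    base : ∀ a b → (a - b) * 0ℤ ≡ 1ℤ - 1ℤ
    base = solve-∀
  Φ-factor a b (suc n) = begin
    (a - b) * (a ^ n + b * Φ a b n)            ≡⟨ distrib a b (a ^ n) (Φ a b n) ⟩
    (a - b) * a ^ n + b * ((a - b) * Φ a b n)  ≡⟨ cong (λ t → (a - b) * a ^ n + b * t) (Φ-factor a b n) ⟩
    (a - b) * a ^ n + b * (a ^ n - b ^ n)      ≡⟨ collect a b (a ^ n) (b ^ n) ⟩
    a * a ^ n - b * b ^ n                      ∎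
    where
    open ≡-Reasoning
    distrib : ∀ a b u F → (a - b) * (u + b * F) ≡ (a - b) * u + b * ((a - b) * F)
    distrib = solve-∀
    collect : ∀ a b u v → (a - b) * u + b * (u - v) ≡ a * u - b * v
    collect = solve-∀

  -- Since a ≡ b modulo a - b, every term of b * Φ a b n is ≡ bⁿ, so
  -- b * Φ a b n ≡ n * bⁿ (mod a - b).
  Φ-congruence : ∀ a b n → (a - b) Signed.∣ (+ n * b ^ n - b * Φ a b n)
  Φ-congruence a b zero    = Signed.divides 0ℤ (base a b)
    where
    base : ∀ a b → + 0 * 1ℤ - b * 0ℤ ≡ 0ℤ * (a - b)
    base = solve-∀
  Φ-congruence a b (suc n) =
    subst (a - b Signed.∣_) (sym step)
      (Signed.∣m∣n⇒∣m-n (Signed.∣n⇒∣m*n b (Φ-congruence a b n))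
                        (Signed.∣n⇒∣m*n (b * Φ a b n) Signed.∣-refl))
    where
    open ≡-Reasoning
    regroup : ∀ b N u v F → (1ℤ + N) * (b * v) - b * (u + b * F) ≡
                            b * (N * v - b * F) - b * (u - v)
    regroup = solve-∀
    commute : ∀ a b F X → b * X - b * ((a - b) * F) ≡ b * X - b * F * (a - b)
    commute = solve-∀
    step : + suc n * b ^ suc n - b * Φ a b (suc n) ≡
           b * (+ n * b ^ n - b * Φ a b n) - b * Φ a b n * (a - b)
    step = begin
      (1ℤ + + n) * (b * b ^ n) - b * (a ^ n + b * Φ a b n)
        ≡⟨ regroup b (+ n) (a ^ n) (b ^ n) (Φ a b n) ⟩
      b * (+ n * b ^ n - b * Φ a b n) - b * (a ^ n - b ^ n)
        ≡⟨ cong (λ t → b * (+ n * b ^ n - b * Φ a b n) - b * t) (sym (Φ-factor a b n)) ⟩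
      b * (+ n * b ^ n - b * Φ a b n) - b * ((a - b) * Φ a b n)
        ≡⟨ commute a b (Φ a b n) (+ n * b ^ n - b * Φ a b n) ⟩
      b * (+ n * b ^ n - b * Φ a b n) - b * Φ a b n * (a - b) ∎

  -- A common divisor of a - b and Φ a b n is coprime to b (because a and b
  -- are coprime), and divides n * bⁿ by the congruence above; so it divides n.
  common-divisor∣exponent : ∀ {a b} n {d} → Coprime a b →
                            + d ∣ a - b → + d ∣ Φ a b n → d ℕ.∣ n
  common-divisor∣exponent {a} {b} n {d} a⊥b d∣a-b d∣Φ =
    ℕ.coprime-divisor (ℕ.sym (coprime-^ˡ n (ℕ.sym d⊥b))) d∣bⁿn
    where
    d⊥b : ℕ.Coprime d ∣ b ∣
    d⊥b {e} (e∣d , e∣b) = a⊥b (Signed.∣⇒∣ᵤ e∣a , e∣b)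
      where
      a-b+b≡a : ∀ a b → a - b + b ≡ a
      a-b+b≡a = solve-∀
      e∣a : + e Signed.∣ a
      e∣a = subst (+ e Signed.∣_) (a-b+b≡a a b)
              (Signed.∣m∣n⇒∣m+n (Signed.∣ᵤ⇒∣ {+ e} {a - b} (ℕ.∣-trans e∣d d∣a-b))
                                 (Signed.∣ᵤ⇒∣ {+ e} {b} e∣b))
    X-Y+Y≡X : ∀ X Y → X - Y + Y ≡ X
    X-Y+Y≡X = solve-∀
    d∣nbⁿ : + d Signed.∣ + n * b ^ n
    d∣nbⁿ = subst (+ d Signed.∣_) (X-Y+Y≡X (+ n * b ^ n) (b * Φ a b n))
              (Signed.∣m∣n⇒∣m+n (Signed.∣-trans (Signed.∣ᵤ⇒∣ d∣a-b) (Φ-congruence a b n))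
                                 (Signed.∣n⇒∣m*n b (Signed.∣ᵤ⇒∣ d∣Φ)))
    d∣bⁿn : d ℕ.∣ ∣ b ∣ ℕ.^ n ℕ.* n
    d∣bⁿn = subst (d ℕ.∣_)
              (trans (abs-* (+ n) (b ^ n))
                     (trans (cong (n ℕ.*_) (abs-^ b n)) (ℕ.*-comm n (∣ b ∣ ℕ.^ n))))
              (Signed.∣⇒∣ᵤ d∣nbⁿ)

  coprime-difference-Φ : ∀ {p a b} → Prime p → Coprime a b → ¬ (+ p ∣ a - b) →
                         Coprime (a - b) (Φ a b p)
  coprime-difference-Φ {p} pp a⊥b p∤a-b (d∣a-b , d∣Φ)
    with prime⇒irreducible pp (common-divisor∣exponent p a⊥b d∣a-b d∣Φ)
  ... | inj₁ d≡1 = d≡1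
  ... | inj₂ refl = ⊥-elim (p∤a-b d∣a-b)

open import Defs
open import Data.Nat using (ℕ)
open import Data.Nat.Primality using (Prime)
open import Data.Integer using (ℤ; +_; _-_; _^_)
open import Data.Integer.Divisibility using (_∣_)
open import Data.Integer.Coprimality using (Coprime)
open import Data.Product using (_×_; ∃-syntax)
open import Relation.Nullary using (¬_)
open import Relation.Binary.PropositionalEquality using (_≡_; _≢_)

import Data.Nat as ℕ
open import Data.Nat.Primality using (prime⇒nonZero)
open import Data.Integer using (_*_; ∣_∣; 0ℤ; _≤_)
open import Data.Integer.Properties using (abs-*; i≤j⇒0≤j-i; 0≤i-j⇒j≤i)
import Data.Integer.Divisibility.Signed as Signed
open import Data.Product using (_,_; proj₂)
open import Data.Sum using (_⊎_; inj₁; inj₂)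
open import Data.Empty using (⊥-elim)
open import Relation.Binary.PropositionalEquality using (sym; trans; cong; subst)
open CoprimeFactorsOfPowers using (coprime-factor-of-power)
open IntegerPowers using (Odd; prime⇒≡2∨odd; abs-^; ^-cancelˡ-≤-odd; root-from-abs; square-nonneg)
open GeometricSum using (Φ; Φ-factor; coprime-difference-Φ)

lemma2 : (p q : ℕ) → Prime p → Prime q → ¬ (p ≡ 2 × q ≡ 2) →
         (a b c : ℤ) → a ≢ b → Coprime a b →
         a ^ p - b ^ p ≡ c ^ q → ¬ (+ p ∣ c ^ q) →
         ∃[ d ] (a - b ≡ d ^ q)
lemma2 p q pp pq not-both-2 a b c _ a⊥b aᵖ-bᵖ≡cᵍ p∤cᵍ =
  root-from-abs (a - b) (proj₂ ∣a-b∣-is-power) (nonneg∨odd (prime⇒≡2∨odd pq))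
  where
  factorisation : (a - b) * Φ a b p ≡ c ^ q
  factorisation = trans (Φ-factor a b p) aᵖ-bᵖ≡cᵍ
  p∤a-b : ¬ (+ p ∣ a - b)
  p∤a-b p∣a-b = p∤cᵍ (Signed.∣⇒∣ᵤ (subst (+ p Signed.∣_) factorisation
                  (Signed.∣m⇒∣m*n (Φ a b p) (Signed.∣ᵤ⇒∣ {+ p} {a - b} p∣a-b))))
  ∣a-b∣-is-power : ∃[ t ] (∣ a - b ∣ ≡ t ℕ.^ q)
  ∣a-b∣-is-power =
    coprime-factor-of-power q {{prime⇒nonZero pq}} (∣ a - b ∣) (∣ Φ a b p ∣) (∣ c ∣)
      (coprime-difference-Φ pp a⊥b p∤a-b)
      (trans (sym (abs-* (a - b) (Φ a b p))) (trans (cong ∣_∣ factorisation) (abs-^ c q)))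
  -- If q = 2 then p is odd, and a^p - b^p = c^2 ≥ 0 forces a ≥ b.
  nonneg∨odd : q ≡ 2 ⊎ Odd q → 0ℤ ≤ a - b ⊎ Odd q
  nonneg∨odd (inj₂ q-odd) = inj₂ q-odd
  nonneg∨odd (inj₁ q≡2) with prime⇒≡2∨odd pp
  ... | inj₁ p≡2   = ⊥-elim (not-both-2 (p≡2 , q≡2))
  ... | inj₂ p-odd = inj₁ (i≤j⇒0≤j-i (^-cancelˡ-≤-odd p-odd (0≤i-j⇒j≤i 0≤aᵖ-bᵖ)))
    where
    0≤aᵖ-bᵖ : 0ℤ ≤ a ^ p - b ^ p
    0≤aᵖ-bᵖ = subst (0ℤ ≤_) (sym (trans aᵖ-bᵖ≡cᵍ (cong (c ^_) q≡2))) (square-nonneg c)
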